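{- Consider keys $I_{15}=\{1,\dots,15\}$ with weights $p_1=p_{15}=7$, $p_k=5$ for even $k$, and $p_k=0$ for odd $k\in\{3,5,\dots,13\}$. Let $T^*$ be an optimal tree for the subproblem $(I_{15},2)$. Then $T^*$ contains a subtree $T'$ that is not an optimal tree for its own subproblem $(I',h')$.
   Context: A two-way-comparison search tree for a query set $S$ is a rooted binary tree whose internal nodes each have two children and are labeled by a key and an operator (equality or less-than), with $|S|$ leaves labeled by distinct elements of $S$; the search for $v$ follows comparison outcomes from the root, and the tree is correct if the search for each $v\in S$ ends at the leaf labeled $v$. Its cost is $\sum_{v\in S}p_v\,\mathrm{depth}(v)$. An optimal tree for the subproblem $(I,h)$ ($I$ an interval of keys) is a correct tree of minimum cost among all correct trees for query sets $I\setminus H$ with $H\subseteq I$, $|H|=h$. For a subtree $T'$ of a tree for $(I,h)$ rooted at node $N$, its subproblem $(I',h')$ is given by the interval $I'$ of keys of $I$ consistent with all less-than comparison outcomes on the path from the root to $N$, and $h'=|I'|-(\text{number of leaves of }T')$; $T'$ is a correct tree for a query set $I'\setminus H'$ with $|H'|=h'$. -}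

module Defs where

open import Data.Nat using (ℕ; zero; suc; _+_; _*_; _∸_; _≤_; _<_)
open import Data.Nat.Properties using (_≟_; _<?_)
open import Data.Bool using (Bool; true; false; if_then_else_)
open import Data.List using (List; []; _∷_; length; filter; map; _++_)
open import Data.Nat.ListAction using (sum)
open import Data.List.Relation.Unary.All using (All)
open import Data.List.Relation.Unary.Unique.Propositional using (Unique)
open import Data.List.Membership.Propositional using (_∈_)
open import Data.List.Membership.DecPropositional _≟_ using (_∈?_)
open import Data.Product using (Σ; _×_; _,_)
open import Relation.Nullary using (¬_; ¬?; does)
open import Relation.Binary.PropositionalEquality using (_≡_)

data Op : Set where
  eqOp : Op
  ltOp : Op

-- Convention: the LEFT child is the branch taken when the comparison is true.
data Tree : Set where
  leaf : ℕ → Tree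
  node : ℕ → Op → Tree → Tree → Tree

test : Op → ℕ → ℕ → Bool
test eqOp k v = does (v ≟ k)
test ltOp k v = does (v <? k)

search : Tree → ℕ → ℕ
search (leaf a) v = a
search (node k o l r) v = if test o k v then search l v else search r v

labels : Tree → List ℕ
labels (leaf a) = a ∷ []
labels (node k o l r) = labels l ++ labels r

leafDepths : Tree → List (ℕ × ℕ)
leafDepths (leaf a) = (a , 0) ∷ []
leafDepths (node k o l r) =
  map (λ { (a , d) → (a , suc d) }) (leafDepths l ++ leafDepths r)

-- cost = Σ_{leaves} p(label) * depth ; for a correct tree this is Σ_{v∈S} p_v depth(v)
cost : (ℕ → ℕ) → Tree → ℕ
cost p T = sum (map (λ { (a , d) → p a * d }) (leafDepths T))

Correct : Tree → List ℕ → Set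
Correct T S =
  Unique (labels T) × All (_∈ S) (labels T) × length (labels T) ≡ length S
  × All (λ v → search T v ≡ v) S

minus : List ℕ → List ℕ → List ℕ
minus I H = filter (λ v → ¬? (v ∈? H)) I

CorrectSub : Tree → List ℕ → ℕ → Set
CorrectSub T I h =
  Σ (List ℕ) λ H → Unique H × All (_∈ I) H × length H ≡ h × Correct T (minus I H)

Optimal : (ℕ → ℕ) → Tree → List ℕ → ℕ → Set
Optimal p T I h =
  CorrectSub T I h × (∀ T₂ → CorrectSub T₂ I h → cost p T ≤ cost p T₂)

-- SubtreeOf T I T' I' : T' is a subtree of T (rooted at some node N), and I'
-- is the set of keys of I consistent with all less-than outcomes on the path
-- from the root of T to N.
data SubtreeOf : Tree → List ℕ → Tree → List ℕ → Set where
  here : ∀ {T I} → SubtreeOf T I T I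
  eqL  : ∀ {k l r I T' I'} → SubtreeOf l I T' I' → SubtreeOf (node k eqOp l r) I T' I'
  eqR  : ∀ {k l r I T' I'} → SubtreeOf r I T' I' → SubtreeOf (node k eqOp l r) I T' I'
  ltL  : ∀ {k l r I T' I'} → SubtreeOf l (filter (λ v → v <? k) I) T' I'
       → SubtreeOf (node k ltOp l r) I T' I'
  ltR  : ∀ {k l r I T' I'} → SubtreeOf r (filter (λ v → ¬? (v <? k)) I) T' I'
       → SubtreeOf (node k ltOp l r) I T' I'

range : ℕ → ℕ → List ℕ
range lo zero = []
range lo (suc n) = lo ∷ range (suc lo) n

I15 : List ℕ
I15 = range 1 15

-- weights: p₁ = p₁₅ = 7, p_k = 5 for even k, p_k = 0 for odd k ∈ {3,...,13}
-- (keys outside I₁₅ get weight 0; they are never queried)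
w : ℕ → ℕ
w 1 = 7
w 2 = 5
w 3 = 0
w 4 = 5
w 5 = 0
w 6 = 5
w 7 = 0
w 8 = 5
w 9 = 0
w 10 = 5
w 11 = 0
w 12 = 5
w 13 = 0
w 14 = 5
w 15 = 7
w _ = 0

-- An optimal tree T* costs at most 115, the cost of the tree T₀ below.  Lower bounds come from a
-- dynamic program over key intervals [lo, hi) and leaf counts m: mw lo hi m is the least weight of
-- m distinct keys of [lo, hi), and dt lo hi m the least cost that the recursion through equality
-- and less-than roots allows for a tree with m leaves in [lo, hi).  Evaluating the bounds shows
-- that T* has a less-than root at some k with m₁ of its 13 leaves on the left, where (k, m₁) is
-- (7, 5), (8, 6), (9, 7) or (10, 8).  For k = 7, 8 the right subtree cannot afford the heavy key
-- 15, so its leaves lie in [k, 15) and it costs at least dt k 15 (13 - m₁) = 50, whereas its own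
-- subproblem has a correct tree of cost 49, one that does answer 15.  For k = 9, 10 the left
-- subtree and the key 1 play these roles.
module Submission where

open import Defs
open import Data.Nat using (ℕ; zero; suc; _+_; _*_; _∸_; _≤_; _<_; z≤n; s≤s; _⊓′_)
open import Data.Nat.Properties
open import Data.Nat.ListAction using (sum)
open import Data.Nat.ListAction.Properties using (sum-++; sum-↭)
open import Data.Bool using (true; false)
open import Data.Unit using (tt)
open import Data.List using (List; []; _∷_; _++_; map; length; filter; upTo; head; drop; zipWith; replicate; foldr; concatMap)
open import Data.Maybe using (fromMaybe)
open import Data.List.Properties using (length-++; map-++; map-∘)
open import Data.List.Relation.Unary.All as All using (All; []; _∷_)
open import Data.List.Relation.Unary.All.Properties using (++⁻ˡ; ++⁻ʳ)
open import Data.List.Relation.Unary.Any using (here; there; any?)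
open import Data.List.Relation.Unary.AllPairs using ([]; _∷_)
open import Data.List.Relation.Unary.Unique.Propositional using (Unique)
open import Data.List.Relation.Unary.Unique.DecPropositional _≟_ using (unique?)
open import Data.List.Relation.Binary.Disjoint.Propositional using (Disjoint)
open import Data.List.Membership.Propositional using (_∈_)
open import Data.List.Membership.DecPropositional _≟_ using (_∈?_)
open import Data.List.Membership.Propositional.Properties using (∈-++⁺ˡ; ∈-++⁺ʳ; ∈-∃++; ∈-filter⁻)
open import Data.List.Relation.Binary.Permutation.Propositional using (_↭_; ↭⇒↭ₛ)
open import Data.List.Relation.Binary.Permutation.Propositional.Properties using (shift; ↭-length; All-resp-↭; map⁺)
open import Data.Product using (Σ; _×_; _,_; proj₁; proj₂)
open import Data.Product.Properties using (≡-dec)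
open import Data.Empty using (⊥-elim)
open import Function using (_∘_; _|>_)
open import Relation.Nullary using (Dec; yes; no; does; ¬_; ¬?)
open import Relation.Nullary.Decidable using (map′; _×-dec_; _→-dec_; from-yes; True; toWitness)
open import Relation.Binary.PropositionalEquality
open import Data.List.Relation.Binary.Permutation.Setoid.Properties (setoid ℕ) using (Unique-resp-↭)
open import Algebra.Properties.CommutativeSemigroup +-commutativeSemigroup using (interchange)

InRange : ℕ → ℕ → ℕ → Set
InRange lo hi a = lo ≤ a × a < hi

narrow-bottom : ∀ {lo hi a} → InRange lo hi a → lo ≢ a → InRange (suc lo) hi a
narrow-bottom (lo≤a , a<hi) lo≢a = ≤∧≢⇒< lo≤a lo≢a , a<hi

narrow-top : ∀ {lo hi a} → InRange lo (suc hi) a → a ≢ hi → InRange lo hi a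
narrow-top (lo≤a , a≤hi) a≢hi = lo≤a , ≤∧≢⇒< (≤-pred a≤hi) a≢hi

weight : (ℕ → ℕ) → List ℕ → ℕ
weight p xs = sum (map p xs)

weight-++ : ∀ p xs ys → weight p (xs ++ ys) ≡ weight p xs + weight p ys
weight-++ p xs ys = trans (cong sum (map-++ p xs ys)) (sum-++ (map p xs) (map p ys))

weight-↭ : ∀ p {Q Q'} → Q ↭ Q' → weight p Q ≡ weight p Q'
weight-↭ p Q↭Q' = sum-↭ (map⁺ p Q↭Q')

Unique-++⁻ : ∀ (xs : List ℕ) {ys} → Unique (xs ++ ys) → Unique xs × Unique ys × Disjoint xs ys
Unique-++⁻ []       u        = [] , u , λ ()
Unique-++⁻ (x ∷ xs) (x∉ ∷ u) with uxs , uys , disj ← Unique-++⁻ xs u =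
  ++⁻ˡ xs x∉ ∷ uxs , uys , λ
    { (here refl , x∈ys)  → All.lookup x∉ (∈-++⁺ʳ xs x∈ys) refl
    ; (there v∈xs , v∈ys) → disj (v∈xs , v∈ys) }

remove-member : ∀ {P : ℕ → Set} {x} {Q : List ℕ} → x ∈ Q → Unique Q → All P Q
  → Σ (List ℕ) λ Q' → Q ↭ x ∷ Q' × Unique Q' × All (λ a → x ≢ a × P a) Q'
remove-member {x = x} x∈Q uQ PQ with ys , zs , refl ← ∈-∃++ x∈Q
  with x∉Q' ∷ uQ' ← Unique-resp-↭ (↭⇒↭ₛ (shift x ys zs)) uQ
  with _ ∷ PQ' ← All-resp-↭ (shift x ys zs) PQ
  = ys ++ zs , shift x ys zs , uQ' , All.zip (x∉Q' , PQ')

unique-constant : ∀ {k} (xs : List ℕ) → Unique xs → All (_≡ k) xs → length xs ≤ 1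
unique-constant []          _               _                = z≤n
unique-constant (_ ∷ [])    _               _                = s≤s z≤n
unique-constant (_ ∷ _ ∷ _) ((x≢y ∷ _) ∷ _) (x≡k ∷ y≡k ∷ _) = ⊥-elim (x≢y (trans x≡k (sym y≡k)))

slack : ∀ {a b c d n} → a + b ≤ n → n < c + d → c ≤ a → b < d
slack {a} {b} {d = d} a+b≤n n<c+d c≤a = +-cancelˡ-< a b d (≤-<-trans a+b≤n (<-≤-trans n<c+d (+-monoˡ-≤ _ c≤a)))

does-true : ∀ {A : Set} (a? : Dec A) → does a? ≡ true → A
does-true (yes a) _ = a

does-false : ∀ {A : Set} (a? : Dec A) → does a? ≡ false → ¬ A
does-false (no ¬a) _ = ¬a

-- Well-formed trees

record WellFormed (T : Tree) : Set where
  constructor wellFormed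
  field
    distinct : Unique (labels T)
    found    : All (λ a → search T a ≡ a) (labels T)

correct⇒wellFormed : ∀ {T S} → Correct T S → WellFormed T
correct⇒wellFormed (distinct , within , _ , found) = wellFormed distinct (All.map (All.lookup found) within)

search-∈ : ∀ T v → search T v ∈ labels T
search-∈ (leaf a)       v = here refl
search-∈ (node k o l r) v with test o k v
... | true  = ∈-++⁺ˡ (search-∈ l v)
... | false = ∈-++⁺ʳ (labels l) (search-∈ r v)

enters-left : ∀ {k o l r a} → Disjoint (labels l) (labels r) → a ∈ labels l
  → search (node k o l r) a ≡ a → test o k a ≡ true × search l a ≡ a
enters-left {k} {o} {l} {r} {a} disj a∈l found with test o k a
... | true  = refl , found
... | false = ⊥-elim (disj (a∈l , subst (_∈ labels r) found (search-∈ r a)))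

enters-right : ∀ {k o l r a} → Disjoint (labels l) (labels r) → a ∈ labels r
  → search (node k o l r) a ≡ a → test o k a ≡ false × search r a ≡ a
enters-right {k} {o} {l} {r} {a} disj a∈r found with test o k a
... | false = refl , found
... | true  = ⊥-elim (disj (subst (_∈ labels l) found (search-∈ l a) , a∈r))

record Routed (k : ℕ) (o : Op) (l r : Tree) : Set where
  field
    left        : WellFormed l
    right       : WellFormed r
    left-tests  : All (λ a → test o k a ≡ true) (labels l)
    right-tests : All (λ a → test o k a ≡ false) (labels r)

routed : ∀ {k o l r} → WellFormed (node k o l r) → Routed k o l r
routed {k} {o} {l} {r} (wellFormed u found) with ul , ur , disj ← Unique-++⁻ (labels l) u = record
  { left        = wellFormed ul (All.map proj₂ entersL)
  ; right       = wellFormed ur (All.map proj₂ entersR)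
  ; left-tests  = All.map proj₁ entersL
  ; right-tests = All.map proj₁ entersR
  }
  where
    entersL : All (λ a → test o k a ≡ true × search l a ≡ a) (labels l)
    entersL = All.tabulate λ a∈l → enters-left {k} {o} {l} {r} disj a∈l (All.lookup found (∈-++⁺ˡ a∈l))
    entersR : All (λ a → test o k a ≡ false × search r a ≡ a) (labels r)
    entersR = All.tabulate λ a∈r → enters-right {k} {o} {l} {r} disj a∈r (All.lookup found (∈-++⁺ʳ (labels l) a∈r))

labels-nonempty : ∀ T → 1 ≤ length (labels T)
labels-nonempty (leaf a)       = s≤s z≤n
labels-nonempty (node k o l r) = begin
  1                                     ≤⟨ labels-nonempty l ⟩
  length (labels l)                     ≤⟨ m≤m+n _ _ ⟩
  length (labels l) + length (labels r) ≡⟨ length-++ (labels l) ⟨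
  length (labels l ++ labels r)         ∎
  where open ≤-Reasoning

sizes : ∀ {N} k o l r → length (labels (node k o l r)) < N → length (labels l) < N × length (labels r) < N
sizes {N} k o l r size = ≤-<-trans (m≤m+n _ _) size′ , ≤-<-trans (m≤n+m _ _) size′
  where size′ = subst (_< N) (length-++ (labels l)) size

range-nonempty : ∀ {lo hi} T → All (InRange lo hi) (labels T) → lo < hi
range-nonempty (leaf a)       ((lo≤a , a<hi) ∷ []) = ≤-<-trans lo≤a a<hi
range-nonempty (node k o l r) inT                  = range-nonempty l (++⁻ˡ (labels l) inT)

lt-ranges : ∀ {k l r lo hi} → WellFormed (node k ltOp l r) → All (InRange lo hi) (labels (node k ltOp l r))
  → All (InRange lo k) (labels l) × All (InRange k hi) (labels r)
lt-ranges {k} {l} wf inT =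
    All.zipWith (λ { ((lo≤a , _) , a<k) → lo≤a , a<k })
      (++⁻ˡ (labels l) inT , All.map (does-true (_ <? k)) (Routed.left-tests (routed wf)))
  , All.zipWith (λ { ((_ , a<hi) , k≤a) → k≤a , a<hi })
      (++⁻ʳ (labels l) inT , All.map (λ {a} → ≮⇒≥ ∘ does-false (a <? k)) (Routed.right-tests (routed wf)))

eq-left-leaf : ∀ {k l r} → WellFormed (node k eqOp l r) → length (labels l) ≡ 1
eq-left-leaf {k} {l} wf = ≤-antisym
  (unique-constant (labels l) (WellFormed.distinct (Routed.left split)) (All.map (does-true (_ ≟ k)) (Routed.left-tests split)))
  (labels-nonempty l)
  where split = routed wf

eq-size : ∀ {k l r} → WellFormed (node k eqOp l r) → length (labels l ++ labels r) ≡ suc (length (labels r))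
eq-size {l = l} wf = trans (length-++ (labels l)) (cong (_+ _) (eq-left-leaf wf))

-- Costs

depthCost : (ℕ → ℕ) → ℕ × ℕ → ℕ
depthCost p (a , d) = p a * d

deeper : ℕ × ℕ → ℕ × ℕ
deeper (a , d) = a , suc d

cost-deeper : ∀ p xs → sum (map (depthCost p) (map deeper xs)) ≡ weight p (map proj₁ xs) + sum (map (depthCost p) xs)
cost-deeper p []             = refl
cost-deeper p ((a , d) ∷ xs) = begin
  p a * suc d + sum (map (depthCost p) (map deeper xs))
    ≡⟨ cong₂ _+_ (*-suc (p a) d) (cost-deeper p xs) ⟩
  (p a + p a * d) + (weight p (map proj₁ xs) + sum (map (depthCost p) xs))
    ≡⟨ interchange (p a) (p a * d) _ _ ⟩
  (p a + weight p (map proj₁ xs)) + (p a * d + sum (map (depthCost p) xs)) ∎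
  where open ≡-Reasoning

labels-leafDepths : ∀ T → map proj₁ (leafDepths T) ≡ labels T
labels-leafDepths (leaf a)       = refl
labels-leafDepths (node k o l r) = begin
  map proj₁ (map deeper (leafDepths l ++ leafDepths r)) ≡⟨ map-∘ (leafDepths l ++ leafDepths r) ⟨
  map proj₁ (leafDepths l ++ leafDepths r)               ≡⟨ map-++ proj₁ (leafDepths l) (leafDepths r) ⟩
  map proj₁ (leafDepths l) ++ map proj₁ (leafDepths r)   ≡⟨ cong₂ _++_ (labels-leafDepths l) (labels-leafDepths r) ⟩
  labels l ++ labels r                                   ∎
  where open ≡-Reasoning

cost-node : ∀ p k o l r → cost p (node k o l r) ≡ weight p (labels l ++ labels r) + (cost p l + cost p r)
cost-node p k o l r = begin
  sum (map (depthCost p) (map deeper (ls ++ rs)))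
    ≡⟨ cost-deeper p (ls ++ rs) ⟩
  weight p (map proj₁ (ls ++ rs)) + sum (map (depthCost p) (ls ++ rs))
    ≡⟨ cong₂ _+_ (cong (weight p) (trans (map-∘ (ls ++ rs)) (labels-leafDepths (node k o l r))))
                 (cong sum (map-++ (depthCost p) ls rs)) ⟩
  weight p (labels l ++ labels r) + sum (map (depthCost p) ls ++ map (depthCost p) rs)
    ≡⟨ cong (weight p (labels l ++ labels r) +_) (sum-++ (map (depthCost p) ls) (map (depthCost p) rs)) ⟩
  weight p (labels l ++ labels r) + (cost p l + cost p r) ∎
  where
    open ≡-Reasoning
    ls = leafDepths l
    rs = leafDepths r

-- The cost of a subtree as seen from its parent, where each of its leaves lies one level deeper.
childCost : (ℕ → ℕ) → Tree → ℕ
childCost p T = weight p (labels T) + cost p T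

cost-node-children : ∀ p k o l r → cost p (node k o l r) ≡ childCost p l + childCost p r
cost-node-children p k o l r = begin
  cost p (node k o l r)
    ≡⟨ cost-node p k o l r ⟩
  weight p (labels l ++ labels r) + (cost p l + cost p r)
    ≡⟨ cong (_+ (cost p l + cost p r)) (weight-++ p (labels l) (labels r)) ⟩
  (weight p (labels l) + weight p (labels r)) + (cost p l + cost p r)
    ≡⟨ interchange (weight p (labels l)) _ _ _ ⟩
  childCost p l + childCost p r ∎
  where open ≡-Reasoning

cheaper-not-optimal : ∀ {p I h} T T₂ → CorrectSub T₂ I h → cost p T₂ < cost p T → ¬ Optimal p T I h
cheaper-not-optimal T T₂ correct₂ cheaper (_ , optimal) = <⇒≱ cheaper (optimal T₂ correct₂)

-- Lower bounds from Bellman inequalities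

childBound : (mw dt : ℕ → ℕ → ℕ → ℕ) → ℕ → ℕ → ℕ → ℕ
childBound mw dt lo hi m = mw lo hi m + dt lo hi m

-- The inequalities that make mw lo hi m a lower bound on the weight of m distinct keys of [lo, hi)
-- and dt lo hi m one on the cost of a well-formed tree with m leaves in [lo, hi), for hi < K, m < N.
record Bellman (p : ℕ → ℕ) (K N : ℕ) (mw dt : ℕ → ℕ → ℕ → ℕ) : Set where
  constructor bellman
  field
    mw-empty : ∀ {lo} → lo < K → mw lo lo 0 ≡ 0
    mw-skip  : ∀ {hi} → hi < K → ∀ {lo} → lo < hi → ∀ {m} → m < N → mw lo hi m ≤ mw (suc lo) hi m
    mw-take  : ∀ {hi} → hi < K → ∀ {lo} → lo < hi → ∀ {m} → m < N → mw lo hi (suc m) ≤ p lo + mw (suc lo) hi m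
    dt-leaf  : ∀ {hi} → hi < K → ∀ {lo} → lo < hi → dt lo hi 1 ≡ 0
    dt-eq    : ∀ {hi} → hi < K → ∀ {lo} → lo < hi → ∀ {m} → m < N
             → dt lo hi (suc m) ≤ mw lo hi (suc m) + dt lo hi m
    dt-lt    : ∀ {hi} → hi < K → ∀ {c} → c < hi → ∀ {lo} → lo < c → ∀ {m₁} → m₁ < N → ∀ {m₂} → m₂ < N
             → dt lo hi (suc m₁ + suc m₂) ≤ childBound mw dt lo c (suc m₁) + childBound mw dt c hi (suc m₂)

bellman? : ∀ p K N mw dt → Dec (Bellman p K N mw dt)
bellman? p K N mw dt =
  (below K (λ lo → mw lo lo 0 ≟ 0)
    ×-dec below K (λ hi → below hi λ lo → below N λ m → mw lo hi m ≤? mw (suc lo) hi m)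
    ×-dec below K (λ hi → below hi λ lo → below N λ m → mw lo hi (suc m) ≤? p lo + mw (suc lo) hi m)
    ×-dec below K (λ hi → below hi λ lo → dt lo hi 1 ≟ 0)
    ×-dec below K (λ hi → below hi λ lo → below N λ m → dt lo hi (suc m) ≤? mw lo hi (suc m) + dt lo hi m)
    ×-dec below K (λ hi → below hi λ c → below c λ lo → below N λ m₁ → below N λ m₂ →
            dt lo hi (suc m₁ + suc m₂) ≤? childBound mw dt lo c (suc m₁) + childBound mw dt c hi (suc m₂)))
  |> map′ (λ (e , s , t , l , q , c) → bellman e s t l q c) (λ (bellman e s t l q c) → e , s , t , l , q , c)
  where
    below : ∀ {P : ℕ → Set} v → (∀ n → Dec (P n)) → Dec (∀ {n} → n < v → P n)
    below v P? = allUpTo? P? v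

module LowerBound {p K N mw dt} (B : Bellman p K N mw dt) where
  open Bellman B

  mw-sound′ : ∀ n {lo hi} {Q : List ℕ} → n + lo ≡ hi → hi < K → Unique Q → All (InRange lo hi) Q → length Q < N
    → mw lo hi (length Q) ≤ weight p Q
  mw-sound′ zero    refl hi<K _ []                  _ = ≤-reflexive (mw-empty hi<K)
  mw-sound′ zero    refl _    _ ((lo≤q , q<lo) ∷ _) _ = ⊥-elim (<⇒≱ q<lo lo≤q)
  mw-sound′ (suc n) {lo} {hi} {Q} gap hi<K uQ inQ |Q|<N = peel (lo ∈? Q)
    where
      open ≤-Reasoning
      lo<hi : lo < hi
      lo<hi = subst (lo <_) gap (s≤s (m≤n+m lo n))
      gap′ : n + suc lo ≡ hi
      gap′ = trans (+-suc n lo) gap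
      peel : Dec (lo ∈ Q) → mw lo hi (length Q) ≤ weight p Q
      peel (no lo∉Q) = begin
        mw lo hi (length Q)       ≤⟨ mw-skip hi<K lo<hi |Q|<N ⟩
        mw (suc lo) hi (length Q) ≤⟨ mw-sound′ n gap′ hi<K uQ inQ′ |Q|<N ⟩
        weight p Q                ∎
        where inQ′ = All.tabulate λ a∈Q → narrow-bottom (All.lookup inQ a∈Q) λ { refl → lo∉Q a∈Q }
      peel (yes lo∈Q) with Q' , Q↭ , uQ' , inQ' ← remove-member lo∈Q uQ inQ = begin
        mw lo hi (length Q)               ≡⟨ cong (mw lo hi) (↭-length Q↭) ⟩
        mw lo hi (suc (length Q'))        ≤⟨ mw-take hi<K lo<hi |Q'|<N ⟩
        p lo + mw (suc lo) hi (length Q') ≤⟨ +-monoʳ-≤ (p lo) (mw-sound′ n gap′ hi<K uQ' inQ″ |Q'|<N) ⟩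
        p lo + weight p Q'                ≡⟨ weight-↭ p Q↭ ⟨
        weight p Q                        ∎
        where
          |Q'|<N = <-trans (n<1+n _) (subst (_< N) (↭-length Q↭) |Q|<N)
          inQ″ = All.map (λ (lo≢a , inRange) → narrow-bottom inRange lo≢a) inQ'

  mw-sound : ∀ {lo hi} {Q : List ℕ} → lo ≤ hi → hi < K → Unique Q → All (InRange lo hi) Q → length Q < N
    → mw lo hi (length Q) ≤ weight p Q
  mw-sound {lo} {hi} lo≤hi = mw-sound′ (hi ∸ lo) (m∸n+n≡m lo≤hi)

  weight-with : ∀ {x lo hi} {Q : List ℕ} → lo ≤ hi → hi < K → x ∈ Q → Unique Q
    → All (λ a → a ≢ x → InRange lo hi a) Q → length Q < N → p x + mw lo hi (length Q ∸ 1) ≤ weight p Q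
  weight-with {x} {lo} {hi} {Q} lo≤hi hi<K x∈Q uQ inQ |Q|<N with Q' , Q↭ , uQ' , inQ' ← remove-member x∈Q uQ inQ = begin
    p x + mw lo hi (length Q ∸ 1) ≡⟨ cong (λ m → p x + mw lo hi (m ∸ 1)) (↭-length Q↭) ⟩
    p x + mw lo hi (length Q')    ≤⟨ +-monoʳ-≤ (p x) (mw-sound lo≤hi hi<K uQ' inQ″ |Q'|<N) ⟩
    p x + weight p Q'             ≡⟨ weight-↭ p Q↭ ⟨
    weight p Q                    ∎
    where
      open ≤-Reasoning
      |Q'|<N = <-trans (n<1+n _) (subst (_< N) (↭-length Q↭) |Q|<N)
      inQ″ = All.map (λ (x≢a , inRange) → inRange (x≢a ∘ sym)) inQ'

  dt-split : ∀ {lo c hi m₁ m₂} → hi < K → lo < c → c < hi → 1 ≤ m₁ → 1 ≤ m₂ → m₁ + m₂ < N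
    → dt lo hi (m₁ + m₂) ≤ childBound mw dt lo c m₁ + childBound mw dt c hi m₂
  dt-split {m₁ = suc m₁} {m₂ = suc m₂} hi<K lo<c c<hi _ _ size =
    dt-lt hi<K c<hi lo<c (≤-<-trans (≤-trans (n≤1+n m₁) (m≤m+n (suc m₁) (suc m₂))) size)
                         (≤-<-trans (≤-trans (n≤1+n m₂) (m≤n+m (suc m₂) (suc m₁))) size)

  mutual
    dt-sound : ∀ {lo hi} T → hi < K → WellFormed T → All (InRange lo hi) (labels T) → length (labels T) < N
      → dt lo hi (length (labels T)) ≤ cost p T
    dt-sound (leaf a) hi<K _ inT _ = ≤-trans (≤-reflexive (dt-leaf hi<K (range-nonempty (leaf a) inT))) z≤n
    dt-sound {lo} {hi} (node k eqOp l r) hi<K wf inT size = begin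
      dt lo hi (length (labels l ++ labels r))
        ≡⟨ cong (dt lo hi) (eq-size wf) ⟩
      dt lo hi (suc (length (labels r)))
        ≤⟨ dt-eq hi<K (range-nonempty (node k eqOp l r) inT) (proj₂ (sizes k eqOp l r size)) ⟩
      mw lo hi (suc (length (labels r))) + dt lo hi (length (labels r))
        ≤⟨ eq-node-bound k l r hi<K wf inT size ⟩
      cost p (node k eqOp l r) ∎
      where open ≤-Reasoning
    dt-sound {lo} {hi} (node k ltOp l r) hi<K wf inT size = begin
      dt lo hi (length (labels l ++ labels r))
        ≡⟨ cong (dt lo hi) (length-++ (labels l)) ⟩
      dt lo hi (length (labels l) + length (labels r))
        ≤⟨ dt-split hi<K (range-nonempty l inl) (range-nonempty r inr) (labels-nonempty l) (labels-nonempty r)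
                    (subst (_< N) (length-++ (labels l)) size) ⟩
      childBound mw dt lo k (length (labels l)) + childBound mw dt k hi (length (labels r))
        ≤⟨ lt-node-bound k l r hi<K wf inT size ⟩
      cost p (node k ltOp l r) ∎
      where
        open ≤-Reasoning
        inl = proj₁ (lt-ranges wf inT)
        inr = proj₂ (lt-ranges wf inT)

    childCost-bound : ∀ {lo hi} T → hi < K → WellFormed T → All (InRange lo hi) (labels T) → length (labels T) < N
      → childBound mw dt lo hi (length (labels T)) ≤ childCost p T
    childCost-bound T hi<K wf inT size =
      +-mono-≤ (mw-sound (<⇒≤ (range-nonempty T inT)) hi<K (WellFormed.distinct wf) inT size) (dt-sound T hi<K wf inT size)

    eq-node-bound : ∀ {lo hi} k l r → hi < K → WellFormed (node k eqOp l r) → All (InRange lo hi) (labels (node k eqOp l r))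
      → length (labels (node k eqOp l r)) < N
      → mw lo hi (suc (length (labels r))) + dt lo hi (length (labels r)) ≤ cost p (node k eqOp l r)
    eq-node-bound {lo} {hi} k l r hi<K wf inT size = begin
      mw lo hi (suc (length (labels r))) + dt lo hi (length (labels r))
        ≡⟨ cong (λ m → mw lo hi m + _) (eq-size wf) ⟨
      mw lo hi (length (labels l ++ labels r)) + dt lo hi (length (labels r))
        ≤⟨ +-mono-≤ (mw-sound (<⇒≤ (range-nonempty (node k eqOp l r) inT)) hi<K (WellFormed.distinct wf) inT size)
                    (dt-sound r hi<K (Routed.right (routed wf)) (++⁻ʳ (labels l) inT) (proj₂ (sizes k eqOp l r size))) ⟩
      weight p (labels l ++ labels r) + cost p r
        ≤⟨ +-monoʳ-≤ (weight p (labels l ++ labels r)) (m≤n+m (cost p r) (cost p l)) ⟩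
      weight p (labels l ++ labels r) + (cost p l + cost p r)
        ≡⟨ cost-node p k eqOp l r ⟨
      cost p (node k eqOp l r) ∎
      where open ≤-Reasoning

    lt-node-bound : ∀ {lo hi} k l r → hi < K → WellFormed (node k ltOp l r) → All (InRange lo hi) (labels (node k ltOp l r))
      → length (labels (node k ltOp l r)) < N
      → childBound mw dt lo k (length (labels l)) + childBound mw dt k hi (length (labels r)) ≤ cost p (node k ltOp l r)
    lt-node-bound k l r hi<K wf inT size = begin
      _ ≤⟨ +-mono-≤ (childCost-bound l (<-trans (range-nonempty r inr) hi<K) (Routed.left split) inl |l|<N)
                    (childCost-bound r hi<K (Routed.right split) inr |r|<N) ⟩
      childCost p l + childCost p r ≡⟨ cost-node-children p k ltOp l r ⟨
      cost p (node k ltOp l r)      ∎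
      where
        open ≤-Reasoning
        split = routed wf
        inl = proj₁ (lt-ranges wf inT)
        inr = proj₂ (lt-ranges wf inT)
        |l|<N = proj₁ (sizes k ltOp l r size)
        |r|<N = proj₂ (sizes k ltOp l r size)

  avoids : ∀ {x lo hi lo' hi'} T → lo' ≤ hi' → hi' < K → hi < K → WellFormed T → All (InRange lo hi) (labels T)
    → (∀ {a} → InRange lo hi a → a ≢ x → InRange lo' hi' a) → length (labels T) < N
    → childCost p T < p x + mw lo' hi' (length (labels T) ∸ 1) + dt lo hi (length (labels T))
    → All (InRange lo' hi') (labels T)
  avoids {x} T lo'≤hi' hi'<K hi<K wf inT narrow size light with x ∈? labels T
  ... | no x∉T  = All.tabulate λ a∈T → narrow (All.lookup inT a∈T) λ { refl → x∉T a∈T }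
  ... | yes x∈T = ⊥-elim (<⇒≱ light (+-mono-≤ heavy (dt-sound T hi<K wf inT size)))
    where heavy = weight-with lo'≤hi' hi'<K x∈T (WellFormed.distinct wf) (All.map narrow inT) size

-- The bounds for the weights w, by dynamic programming

-- Stands for the weight of more keys than an interval holds; any value above the budget 115 would do.
∞ : ℕ
∞ = 1000

at : {A : Set} → A → List A → ℕ → A
at d xs i = fromMaybe d (head (drop i xs))

Grid : Set → Set
Grid A = List (List A)

grid : {A : Set} → ℕ → (ℕ → ℕ → A) → Grid A
grid K f = map (λ lo → map (f lo) (upTo K)) (upTo K)

addKey : ℕ → List ℕ → List ℕ
addKey c row = at 0 row 0 ∷ zipWith _⊓′_ (drop 1 row) (map (c +_) row)

-- Entry m of cheapest p N ks, for m ≤ N, is the least weight of m distinct keys from ks.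
cheapest : (ℕ → ℕ) → ℕ → List ℕ → List ℕ
cheapest p N []       = 0 ∷ replicate N ∞
cheapest p N (x ∷ xs) = addKey (p x) (cheapest p N xs)

mwTable : (ℕ → ℕ) → ℕ → ℕ → Grid (List ℕ)
mwTable p K N = grid K λ lo hi → cheapest p N (range lo (hi ∸ lo))

mwAt : Grid (List ℕ) → ℕ → ℕ → ℕ → ℕ
mwAt t lo hi m = at 0 (at [] (at [] t lo) hi) m

dtAt : List (Grid ℕ) → ℕ → ℕ → ℕ → ℕ
dtAt t lo hi m = at 0 (at [] (at [] t m) lo) hi

bellmanMin : (mw dt : ℕ → ℕ → ℕ → ℕ) → ℕ → ℕ → ℕ → ℕ
bellmanMin mw dt lo hi m = foldr _⊓′_ (mw lo hi m + dt lo hi (m ∸ 1))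
  (concatMap (λ c → map (λ m₁ → childBound mw dt lo c m₁ + childBound mw dt c hi (m ∸ m₁)) (range 1 (m ∸ 1)))
             (range (suc lo) (hi ∸ suc lo)))

-- Grid number m holds the values for m leaves, up to m = n + 1; grid 0 is junk.
dtLevels : (mw : ℕ → ℕ → ℕ → ℕ) → ℕ → ℕ → List (Grid ℕ)
dtLevels mw K zero    = grid K (λ _ _ → 0) ∷ grid K (λ _ _ → 0) ∷ []
dtLevels mw K (suc n) = extend (dtLevels mw K n)
  where
    extend : List (Grid ℕ) → List (Grid ℕ)
    extend ds = ds ++ grid K (λ lo hi → bellmanMin mw (dtAt ds) lo hi (length ds)) ∷ []

mw dt : ℕ → ℕ → ℕ → ℕ
mw = mwAt (mwTable w 17 14)
dt = dtAt (dtLevels mw 17 12)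

-- Decision procedures are applied to mw and dt as arguments: the evaluator then computes the
-- tables once and shares them, whereas every unfolding of the constants mw, dt recomputes them.
certificate : Bellman w 17 14 mw dt
certificate = from-yes (bellman? w 17 14 mw dt)

open LowerBound certificate

-- The instance (I₁₅, 2)

correctWithout? : ∀ T I h H → Dec (Unique H × All (_∈ I) H × length H ≡ h × Correct T (minus I H))
correctWithout? T I h H =
  unique? H ×-dec All.all? (_∈? I) H ×-dec length H ≟ h
    ×-dec unique? (labels T) ×-dec All.all? (_∈? minus I H) (labels T)
    ×-dec length (labels T) ≟ length (minus I H) ×-dec All.all? (λ v → search T v ≟ v) (minus I H)

correctSub-by : ∀ T I h H → True (correctWithout? T I h H) → CorrectSub T I h
correctSub-by T I h H ok = H , toWitness ok

eqThen : ℕ → Tree → Tree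
eqThen k t = node k eqOp (leaf k) t

T₀ : Tree
T₀ = node 7 ltOp (eqThen 2 (eqThen 4 (eqThen 6 (eqThen 3 (leaf 5)))))
                 (eqThen 8 (eqThen 10 (eqThen 12 (eqThen 14 (eqThen 7 (eqThen 9 (eqThen 11 (leaf 13))))))))

T₀-correct : CorrectSub T₀ I15 2
T₀-correct = correctSub-by T₀ I15 2 (1 ∷ 15 ∷ []) tt

tree≥7 tree≥8 tree<9 tree<10 : Tree
tree≥7  = node 14 ltOp (eqThen 8 (eqThen 10 (eqThen 7 (eqThen 9 (eqThen 11 (leaf 13)))))) (eqThen 14 (leaf 15))
tree≥8  = node 14 ltOp (eqThen 8 (eqThen 10 (eqThen 9 (eqThen 11 (leaf 13))))) (eqThen 14 (leaf 15))
tree<9  = node 3 ltOp (eqThen 1 (leaf 2)) (eqThen 4 (eqThen 6 (eqThen 3 (eqThen 5 (leaf 7)))))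
tree<10 = node 3 ltOp (eqThen 1 (leaf 2)) (eqThen 4 (eqThen 6 (eqThen 3 (eqThen 5 (eqThen 7 (leaf 9))))))

tree≥7-correct : CorrectSub tree≥7 (filter (λ v → ¬? (v <? 7)) I15) 1
tree≥7-correct = correctSub-by tree≥7 _ 1 (12 ∷ []) tt

tree≥8-correct : CorrectSub tree≥8 (filter (λ v → ¬? (v <? 8)) I15) 1
tree≥8-correct = correctSub-by tree≥8 _ 1 (12 ∷ []) tt

tree<9-correct : CorrectSub tree<9 (filter (λ v → v <? 9) I15) 1
tree<9-correct = correctSub-by tree<9 _ 1 (8 ∷ []) tt

tree<10-correct : CorrectSub tree<10 (filter (λ v → v <? 10) I15) 1
tree<10-correct = correctSub-by tree<10 _ 1 (8 ∷ []) tt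

record Candidate (T : Tree) : Set where
  field
    well-formed : WellFormed T
    in-range    : All (InRange 1 16) (labels T)
    size        : length (labels T) ≡ 13
    budget      : cost w T ≤ 115

  size<14 : length (labels T) < 14
  size<14 = subst (_< 14) (sym size) (n<1+n 13)

record Split (k : ℕ) (l r : Tree) : Set where
  field
    left        : WellFormed l
    right       : WellFormed r
    left-range  : All (InRange 1 k) (labels l)
    right-range : All (InRange k 16) (labels r)
    left-size   : length (labels l) < 14
    right-size  : length (labels r) < 14
    budget      : childCost w l + childCost w r ≤ 115

  k<16 : k < 16
  k<16 = range-nonempty r right-range

split : ∀ {k l r} → Candidate (node k ltOp l r) → Split k l r
split {k} {l} {r} c = record
  { left        = Routed.left (routed well-formed)
  ; right       = Routed.right (routed well-formed)
  ; left-range  = proj₁ (lt-ranges well-formed in-range)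
  ; right-range = proj₂ (lt-ranges well-formed in-range)
  ; left-size   = proj₁ (sizes k ltOp l r size<14)
  ; right-size  = proj₂ (sizes k ltOp l r size<14)
  ; budget      = subst (_≤ 115) (cost-node-children w k ltOp l r) budget
  }
  where open Candidate c

HasSuboptimalSubtree : Tree → Set
HasSuboptimalSubtree T =
  Σ Tree λ T' → Σ (List ℕ) λ I' → SubtreeOf T I15 T' I' × ¬ Optimal w T' I' (length I' ∸ length (labels T'))

right-suboptimal : ∀ {k l r m₁ m₂} T₂
  → CorrectSub T₂ (filter (λ v → ¬? (v <? k)) I15) (length (filter (λ v → ¬? (v <? k)) I15) ∸ m₂)
  → cost w T₂ < dt k 15 m₂
  → 115 < childBound mw dt 1 k m₁ + (w 15 + mw k 15 (m₂ ∸ 1) + dt k 16 m₂)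
  → length (labels l) ≡ m₁ → length (labels r) ≡ m₂ → Candidate (node k ltOp l r)
  → HasSuboptimalSubtree (node k ltOp l r)
right-suboptimal {k} {l} {r} T₂ correct₂ cheaper tight refl refl c =
  r , _ , ltR here ,
  cheaper-not-optimal {w} r T₂ correct₂ (<-≤-trans cheaper (dt-sound r (≤ᵇ⇒≤ _ _ tt) right below15 right-size))
  where
    open Split (split c)
    below15 : All (InRange k 15) (labels r)
    below15 = avoids r (≤-pred k<16) (≤ᵇ⇒≤ _ _ tt) (≤ᵇ⇒≤ _ _ tt) right right-range narrow-top right-size
      (slack budget tight (childCost-bound l (<-trans k<16 (n<1+n 16)) left left-range left-size))

left-suboptimal : ∀ {k l r m₁ m₂} T₂
  → CorrectSub T₂ (filter (λ v → v <? k) I15) (length (filter (λ v → v <? k) I15) ∸ m₁)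
  → cost w T₂ < dt 2 k m₁
  → 115 < childBound mw dt k 16 m₂ + (w 1 + mw 2 k (m₁ ∸ 1) + dt 1 k m₁)
  → length (labels l) ≡ m₁ → length (labels r) ≡ m₂ → Candidate (node k ltOp l r)
  → HasSuboptimalSubtree (node k ltOp l r)
left-suboptimal {k} {l} {r} T₂ correct₂ cheaper tight refl refl c =
  l , _ , ltL here ,
  cheaper-not-optimal {w} l T₂ correct₂ (<-≤-trans cheaper (dt-sound l k<17 left above1 left-size))
  where
    open Split (split c)
    k<17 = <-trans k<16 (n<1+n 16)
    above1 : All (InRange 2 k) (labels l)
    above1 = avoids l (range-nonempty l left-range) k<17 k<17 left left-range
      (λ inRange a≢1 → narrow-bottom inRange (a≢1 ∘ sym)) left-size
      (slack (subst (_≤ 115) (+-comm (childCost w l) _) budget) tight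
             (childCost-bound r (≤ᵇ⇒≤ _ _ tt) right right-range right-size))

viableSplits : List (ℕ × ℕ)
viableSplits = (7 , 5) ∷ (8 , 6) ∷ (9 , 7) ∷ (10 , 8) ∷ []

ViableSplitsOnly : (mw dt : ℕ → ℕ → ℕ → ℕ) → Set
ViableSplitsOnly mw dt = ∀ {k} → k < 16 → ∀ {m₁} → m₁ < 13 → 1 ≤ m₁
  → childBound mw dt 1 k m₁ + childBound mw dt k 16 (13 ∸ m₁) ≤ 115 → (k , m₁) ∈ viableSplits

viableSplitsOnly? : ∀ mw dt → Dec (ViableSplitsOnly mw dt)
viableSplitsOnly? mw dt = allUpTo? (λ k → allUpTo? (λ m₁ →
  1 ≤? m₁ →-dec childBound mw dt 1 k m₁ + childBound mw dt k 16 (13 ∸ m₁) ≤? 115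
          →-dec any? (≡-dec _≟_ _≟_ (k , m₁)) viableSplits) 13) 16

viable-splits-only : ViableSplitsOnly mw dt
viable-splits-only = from-yes (viableSplitsOnly? mw dt)

viable-case : ∀ {k l r m₁} → (k , m₁) ∈ viableSplits → length (labels l) ≡ m₁ → length (labels r) ≡ 13 ∸ m₁
  → Candidate (node k ltOp l r) → HasSuboptimalSubtree (node k ltOp l r)
viable-case (here refl)                         = right-suboptimal tree≥7 tree≥7-correct (≤ᵇ⇒≤ _ _ tt) (≤ᵇ⇒≤ _ _ tt)
viable-case (there (here refl))                 = right-suboptimal tree≥8 tree≥8-correct (≤ᵇ⇒≤ _ _ tt) (≤ᵇ⇒≤ _ _ tt)
viable-case (there (there (here refl)))         = left-suboptimal tree<9 tree<9-correct (≤ᵇ⇒≤ _ _ tt) (≤ᵇ⇒≤ _ _ tt)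
viable-case (there (there (there (here refl)))) = left-suboptimal tree<10 tree<10-correct (≤ᵇ⇒≤ _ _ tt) (≤ᵇ⇒≤ _ _ tt)

suboptimal-subtree : ∀ T → Candidate T → HasSuboptimalSubtree T
suboptimal-subtree (leaf a) c with () ← Candidate.size c
suboptimal-subtree (node k eqOp l r) c = ⊥-elim (<⇒≱ (≤ᵇ⇒≤ _ _ tt) (≤-trans bound budget))
  where
    open Candidate c
    |r|≡12 : length (labels r) ≡ 12
    |r|≡12 = suc-injective (trans (sym (eq-size well-formed)) size)
    bound : mw 1 16 13 + dt 1 16 12 ≤ cost w (node k eqOp l r)
    bound = subst (λ m → mw 1 16 (suc m) + dt 1 16 m ≤ cost w (node k eqOp l r)) |r|≡12
      (eq-node-bound k l r (≤ᵇ⇒≤ _ _ tt) well-formed in-range size<14)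
suboptimal-subtree (node k ltOp l r) c =
  viable-case (viable-splits-only (Split.k<16 (split c)) |l|<13 (labels-nonempty l) (≤-trans bound budget)) refl |r|≡13∸|l| c
  where
    open Candidate c
    |l|+|r|≡13 : length (labels l) + length (labels r) ≡ 13
    |l|+|r|≡13 = trans (sym (length-++ (labels l))) size
    |l|<13 : length (labels l) < 13
    |l|<13 = subst (length (labels l) <_) |l|+|r|≡13 (m<m+n _ (labels-nonempty r))
    |r|≡13∸|l| : length (labels r) ≡ 13 ∸ length (labels l)
    |r|≡13∸|l| = trans (sym (m+n∸m≡n (length (labels l)) _)) (cong (_∸ length (labels l)) |l|+|r|≡13)
    bound : childBound mw dt 1 k (length (labels l)) + childBound mw dt k 16 (13 ∸ length (labels l)) ≤ cost w (node k ltOp l r)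
    bound = subst (λ m → childBound mw dt 1 k (length (labels l)) + childBound mw dt k 16 m ≤ cost w (node k ltOp l r))
                  |r|≡13∸|l|
      (lt-node-bound k l r (≤ᵇ⇒≤ _ _ tt) well-formed in-range size<14)

∈-range⁻ : ∀ {a} lo n → a ∈ range lo n → InRange lo (lo + n) a
∈-range⁻     lo (suc n) (here refl) = ≤-refl , subst (lo <_) (sym (+-suc lo n)) (s≤s (m≤m+n lo n))
∈-range⁻ {a} lo (suc n) (there a∈) with lo<a , a<end ← ∈-range⁻ (suc lo) n a∈ =
  <⇒≤ lo<a , subst (a <_) (sym (+-suc lo n)) a<end

two-removed : All (λ x → All (λ y → x ≢ y → length (minus I15 (x ∷ y ∷ [])) ≡ 13) I15) I15
two-removed = from-yes
  (All.all? (λ x → All.all? (λ y → ¬? (x ≟ y) →-dec length (minus I15 (x ∷ y ∷ [])) ≟ 13) I15) I15)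

length-minus-two : ∀ {H} → Unique H → All (_∈ I15) H → length H ≡ 2 → length (minus I15 H) ≡ 13
length-minus-two {_ ∷ _ ∷ []} ((x≢y ∷ []) ∷ _) (x∈ ∷ y∈ ∷ []) refl =
  All.lookup (All.lookup two-removed x∈) y∈ x≢y

lemma5 : (T* : Tree) → Optimal w T* I15 2
    → Σ Tree λ T' → Σ (List ℕ) λ I' → SubtreeOf T* I15 T' I'
    × ¬ Optimal w T' I' (length I' ∸ length (labels T'))
lemma5 T* ((H , uH , H⊆I15 , |H|≡2 , correct@(_ , within , |T*|≡|I15-H| , _)) , optimal) =
  suboptimal-subtree T* record
    { well-formed = correct⇒wellFormed correct
    ; in-range    = All.map (∈-range⁻ 1 15 ∘ proj₁ ∘ ∈-filter⁻ (λ v → ¬? (v ∈? H))) within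
    ; size        = trans |T*|≡|I15-H| (length-minus-two uH H⊆I15 |H|≡2)
    ; budget      = optimal T₀ T₀-correct
    }
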